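{- Let $\vdash_*$ be minimal logic $\vdash_m$ plus additional axioms such that ${\vdash_*}\subseteq{\vdash_i}$. (i) In propositional logic the following are equivalent: (a) for all finite sets of formulas $\Gamma$ and formulas $\varphi$, $\Gamma\vdash_i\varphi$ iff $\Gamma\vdash_*\varphi\vee\bot$; (b) $\varphi\to(\psi\vee\bot)\vdash_*(\varphi\to\psi)\vee\bot$ for all $\varphi,\psi$. (ii) Let $\vdash_m^Q,\vdash_*^Q,\vdash_i^Q$ be $\vdash_m,\vdash_*,\vdash_i$ plus quantifiers. In predicate logic the following are equivalent: (a) for all $\Gamma,\varphi$, $\Gamma\vdash_i^Q\varphi$ iff $\Gamma\vdash_*^Q\varphi\vee\bot$; (b) $\varphi\to(\psi\vee\bot)\vdash_*^Q(\varphi\to\psi)\vee\bot$ and $\forall x(\varphi\vee\bot)\vdash_*^Q(\forall x\varphi)\vee\bot$ for all formulas $\varphi,\psi$ and variables $x$.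
   Context: $S$ is a set of propositional (resp. first-order predicate) formulas containing $\top,\bot$ and closed under $\vee,\wedge,\to,\neg$ (and $\forall,\exists$). An entailment relation on $S$ is a relation ${\rhd}\subseteq\mathrm{Fin}(S)\times S$ (finite sets of formulas on the left) satisfying: (R) if $\varphi\in\Gamma$ then $\Gamma\rhd\varphi$; (T) if $\Gamma\rhd\psi$ and $\Gamma',\psi\rhd\varphi$ then $\Gamma,\Gamma'\rhd\varphi$; (M) if $\Gamma\rhd\varphi$ then $\Gamma,\Gamma'\rhd\varphi$. Positive logic $\vdash_p$ is the least entailment relation $\rhd$ satisfying rule R$\to$ (if $\Gamma,\varphi\rhd\psi$ then $\Gamma\rhd\varphi\to\psi$) and the axioms $\varphi,\psi\rhd\varphi\wedge\psi$; $\varphi\wedge\psi\rhd\varphi$; $\varphi\wedge\psi\rhd\psi$; $\varphi\rhd\varphi\vee\psi$; $\psi\rhd\varphi\vee\psi$; $\varphi\vee\psi,\varphi\to\delta,\psi\to\delta\rhd\delta$; $\varphi,\varphi\to\psi\rhd\psi$; $\emptyset\rhd\top$. "Plus additional axioms" means the least entailment relation satisfying the generating axioms and rules together with the new axioms. Minimal logic $\vdash_m$ is $\vdash_p$ plus $\varphi\to\bot\rhd\neg\varphi$ and $\neg\varphi\rhd\varphi\to\bot$; intuitionistic logic $\vdash_i$ is $\vdash_m$ plus $\bot\rhd\varphi$. "Plus quantifiers" means adding to the inductive definition the rules: L$\forall$: from $\varphi[t/x],\Gamma,\forall x\varphi\rhd\delta$ infer $\Gamma,\forall x\varphi\rhd\delta$;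 R$\forall$: from $\Gamma\rhd\varphi[y/x]$ infer $\Gamma\rhd\forall x\varphi$; L$\exists$: from $\Gamma,\varphi[y/x]\rhd\delta$ infer $\Gamma,\exists x\varphi\rhd\delta$; R$\exists$: from $\Gamma\rhd\varphi[t/x]$ infer $\Gamma\rhd\exists x\varphi$; with $y$ fresh in R$\forall$ and L$\exists$. -}

module Defs where

open import Data.Nat using (ℕ; zero; suc)
open import Data.Bool using (Bool; true; false)
open import Data.List using (List; []; _∷_; _++_; map)
open import Data.List.Membership.Propositional using (_∈_)
open import Data.List.Relation.Binary.Subset.Propositional using (_⊆_)
open import Data.Vec using (Vec; []; _∷_)
open import Data.Empty using (⊥)
open import Relation.Binary.PropositionalEquality using (_≡_)

-- Entailment relations are relations between finite sets of formulas
-- (represented as lists, identified up to having the same elements via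
-- the monotonicity rule stated with ⊆) and formulas.

module Prop (A : Set) where

  infixr 6 _∧'_
  infixr 5 _∨'_
  infixr 4 _⇒_

  data Form : Set where
    atom : A → Form
    ⊤' ⊥' : Form
    _∧'_ _∨'_ _⇒_ : Form → Form → Form
    ¬'_ : Form → Form

  NoAx : List Form → Form → Set
  NoAx _ _ = ⊥

  data Der (Ax : List Form → Form → Set) (efq : Bool) : List Form → Form → Set where
    ruleR : ∀ {Γ φ} → φ ∈ Γ → Der Ax efq Γ φ
    ruleT : ∀ {Γ Γ' ψ φ} → Der Ax efq Γ ψ → Der Ax efq (ψ ∷ Γ') φ → Der Ax efq (Γ ++ Γ') φ
    ruleM : ∀ {Γ Δ φ} → Der Ax efq Γ φ → Γ ⊆ Δ → Der Ax efq Δ φ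
    ruleR⇒ : ∀ {Γ φ ψ} → Der Ax efq (φ ∷ Γ) ψ → Der Ax efq Γ (φ ⇒ ψ)
    ∧I : ∀ {φ ψ} → Der Ax efq (φ ∷ ψ ∷ []) (φ ∧' ψ)
    ∧E₁ : ∀ {φ ψ} → Der Ax efq ((φ ∧' ψ) ∷ []) φ
    ∧E₂ : ∀ {φ ψ} → Der Ax efq ((φ ∧' ψ) ∷ []) ψ
    ∨I₁ : ∀ {φ ψ} → Der Ax efq (φ ∷ []) (φ ∨' ψ)
    ∨I₂ : ∀ {φ ψ} → Der Ax efq (ψ ∷ []) (φ ∨' ψ)
    ∨E : ∀ {φ ψ δ} → Der Ax efq ((φ ∨' ψ) ∷ (φ ⇒ δ) ∷ (ψ ⇒ δ) ∷ []) δ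
    ⇒E : ∀ {φ ψ} → Der Ax efq (φ ∷ (φ ⇒ ψ) ∷ []) ψ
    ⊤I : Der Ax efq [] ⊤'
    ¬I : ∀ {φ} → Der Ax efq ((φ ⇒ ⊥') ∷ []) (¬' φ)
    ¬E : ∀ {φ} → Der Ax efq ((¬' φ) ∷ []) (φ ⇒ ⊥')
    efqAx : ∀ {φ} → efq ≡ true → Der Ax efq (⊥' ∷ []) φ
    extra : ∀ {Γ φ} → Ax Γ φ → Der Ax efq Γ φ

  _⊢m_ : List Form → Form → Set
  _⊢m_ = Der NoAx false

  _⊢i_ : List Form → Form → Set
  _⊢i_ = Der NoAx true

  Star : (List Form → Form → Set) → List Form → Form → Set
  Star Ax = Der Ax false

record Signature : Set₁ where
  field
    Func : Set
    funArity : Func → ℕ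
    Pred : Set
    predArity : Pred → ℕ

module FOL (Sig : Signature) where
  open Signature Sig

  data Term : Set where
    var : ℕ → Term
    fn : (f : Func) → Vec Term (funArity f) → Term

  infixr 6 _∧'_
  infixr 5 _∨'_
  infixr 4 _⇒_

  data Form : Set where
    rel : (p : Pred) → Vec Term (predArity p) → Form
    ⊤' ⊥' : Form
    _∧'_ _∨'_ _⇒_ : Form → Form → Form
    ¬'_ : Form → Form
    ∀' ∃' : Form → Form   -- binds de Bruijn index 0

  ext : (ℕ → ℕ) → ℕ → ℕ
  ext ρ zero = zero
  ext ρ (suc n) = suc (ρ n)

  renT : (ℕ → ℕ) → Term → Term
  renTs : ∀ {n} → (ℕ → ℕ) → Vec Term n → Vec Term n
  renT ρ (var x) = var (ρ x)
  renT ρ (fn f ts) = fn f (renTs ρ ts)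
  renTs ρ [] = []
  renTs ρ (t ∷ ts) = renT ρ t ∷ renTs ρ ts

  renF : (ℕ → ℕ) → Form → Form
  renF ρ (rel p ts) = rel p (renTs ρ ts)
  renF ρ ⊤' = ⊤'
  renF ρ ⊥' = ⊥'
  renF ρ (φ ∧' ψ) = renF ρ φ ∧' renF ρ ψ
  renF ρ (φ ∨' ψ) = renF ρ φ ∨' renF ρ ψ
  renF ρ (φ ⇒ ψ) = renF ρ φ ⇒ renF ρ ψ
  renF ρ (¬' φ) = ¬' renF ρ φ
  renF ρ (∀' φ) = ∀' (renF (ext ρ) φ)
  renF ρ (∃' φ) = ∃' (renF (ext ρ) φ)

  -- shifting all free variables up by one (used for freshness)
  shift : Form → Form
  shift = renF suc

  exts : (ℕ → Term) → ℕ → Term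
  exts σ zero = var zero
  exts σ (suc n) = renT suc (σ n)

  subT : (ℕ → Term) → Term → Term
  subTs : ∀ {n} → (ℕ → Term) → Vec Term n → Vec Term n
  subT σ (var x) = σ x
  subT σ (fn f ts) = fn f (subTs σ ts)
  subTs σ [] = []
  subTs σ (t ∷ ts) = subT σ t ∷ subTs σ ts

  subF : (ℕ → Term) → Form → Form
  subF σ (rel p ts) = rel p (subTs σ ts)
  subF σ ⊤' = ⊤'
  subF σ ⊥' = ⊥'
  subF σ (φ ∧' ψ) = subF σ φ ∧' subF σ ψ
  subF σ (φ ∨' ψ) = subF σ φ ∨' subF σ ψ
  subF σ (φ ⇒ ψ) = subF σ φ ⇒ subF σ ψ
  subF σ (¬' φ) = ¬' subF σ φ
  subF σ (∀' φ) = ∀' (subF (exts σ) φ)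
  subF σ (∃' φ) = ∃' (subF (exts σ) φ)

  single : Term → ℕ → Term
  single t zero = t
  single t (suc n) = var n

  _[_] : Form → Term → Form
  φ [ t ] = subF (single t) φ

  NoAx : List Form → Form → Set
  NoAx _ _ = ⊥

  data Der (Ax : List Form → Form → Set) (efq quant : Bool) : List Form → Form → Set where
    ruleR : ∀ {Γ φ} → φ ∈ Γ → Der Ax efq quant Γ φ
    ruleT : ∀ {Γ Γ' ψ φ} → Der Ax efq quant Γ ψ → Der Ax efq quant (ψ ∷ Γ') φ → Der Ax efq quant (Γ ++ Γ') φ
    ruleM : ∀ {Γ Δ φ} → Der Ax efq quant Γ φ → Γ ⊆ Δ → Der Ax efq quant Δ φ
    ruleR⇒ : ∀ {Γ φ ψ} → Der Ax efq quant (φ ∷ Γ) ψ → Der Ax efq quant Γ (φ ⇒ ψ)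
    ∧I : ∀ {φ ψ} → Der Ax efq quant (φ ∷ ψ ∷ []) (φ ∧' ψ)
    ∧E₁ : ∀ {φ ψ} → Der Ax efq quant ((φ ∧' ψ) ∷ []) φ
    ∧E₂ : ∀ {φ ψ} → Der Ax efq quant ((φ ∧' ψ) ∷ []) ψ
    ∨I₁ : ∀ {φ ψ} → Der Ax efq quant (φ ∷ []) (φ ∨' ψ)
    ∨I₂ : ∀ {φ ψ} → Der Ax efq quant (ψ ∷ []) (φ ∨' ψ)
    ∨E : ∀ {φ ψ δ} → Der Ax efq quant ((φ ∨' ψ) ∷ (φ ⇒ δ) ∷ (ψ ⇒ δ) ∷ []) δ
    ⇒E : ∀ {φ ψ} → Der Ax efq quant (φ ∷ (φ ⇒ ψ) ∷ []) ψ
    ⊤I : Der Ax efq quant [] ⊤'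
    ¬I : ∀ {φ} → Der Ax efq quant ((φ ⇒ ⊥') ∷ []) (¬' φ)
    ¬E : ∀ {φ} → Der Ax efq quant ((¬' φ) ∷ []) (φ ⇒ ⊥')
    efqAx : ∀ {φ} → efq ≡ true → Der Ax efq quant (⊥' ∷ []) φ
    extra : ∀ {Γ φ} → Ax Γ φ → Der Ax efq quant Γ φ
    -- quantifier rules (de Bruijn form; freshness = shifting the rest)
    L∀ : ∀ {Γ φ δ} (t : Term) → quant ≡ true →
         Der Ax efq quant ((φ [ t ]) ∷ ∀' φ ∷ Γ) δ → Der Ax efq quant (∀' φ ∷ Γ) δ
    R∀ : ∀ {Γ φ} → quant ≡ true →
         Der Ax efq quant (map shift Γ) φ → Der Ax efq quant Γ (∀' φ)
    L∃ : ∀ {Γ φ δ} → quant ≡ true →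
         Der Ax efq quant (φ ∷ map shift Γ) (shift δ) → Der Ax efq quant (∃' φ ∷ Γ) δ
    R∃ : ∀ {Γ φ} (t : Term) → quant ≡ true →
         Der Ax efq quant Γ (φ [ t ]) → Der Ax efq quant Γ (∃' φ)

  _⊢m_ _⊢i_ : List Form → Form → Set
  _⊢m_ = Der NoAx false false
  _⊢i_ = Der NoAx true false

  Star : (List Form → Form → Set) → List Form → Form → Set
  Star Ax = Der Ax false false

  _⊢mQ_ _⊢iQ_ : List Form → Form → Set
  _⊢mQ_ = Der NoAx false true
  _⊢iQ_ = Der NoAx true true

  StarQ : (List Form → Form → Set) → List Form → Form → Set
  StarQ Ax = Der Ax false true

module Submission where

-- The translation φ ↦ φ ∨ ⊥ turns ⊢i-derivations into ⊢*-derivations rule by rule: ex falso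
-- becomes ∨-introduction into the ⊥ disjunct, a cut on ψ becomes an ∨-elimination of ψ ∨ ⊥,
-- R∃ is applied inside the left disjunct, and the axioms and left rules are untouched.  Only
-- R⇒ and R∀, which place a translated formula under a connective on the right, do not
-- commute with the translation, and condition (b) is precisely what repairs them.  Conversely
-- the instances of (b) are intuitionistically valid, so (a) yields them; and ⊢* ⊆ ⊢i together
-- with φ ∨ ⊥ ⊢i φ gives the other half of (a).

open import Defs
open import Data.Bool using (Bool; true)
open import Data.List using (List; []; _∷_; _++_; map)
open import Data.List.Relation.Unary.All using (All; []; _∷_)
open import Data.List.Relation.Unary.Any using (here; there)
open import Data.List.Membership.Propositional using (_∈_)
open import Data.List.Membership.Propositional.Properties using (∈-++⁻)
open import Data.List.Relation.Binary.Subset.Propositional using (_⊆_)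
open import Data.List.Relation.Binary.Subset.Propositional.Properties
  using (∷⁺ʳ; xs⊆xs++ys; xs⊆ys++xs)
open import Data.Nat using (ℕ; zero; suc)
open import Data.Product using (_×_; _,_)
open import Data.Sum using ([_,_]′)
open import Data.Vec using (Vec; []; _∷_)
open import Function using (id)
open import Function.Bundles using (_⇔_; mk⇔; Equivalence)
open import Relation.Binary.PropositionalEquality using (_≡_; refl; cong; cong₂)

module PositiveEntailment
  {F : Set} (_∨_ _⇒_ : F → F → F) (⊥ : F) (_▷_ : List F → F → Set)
  (ruleR : ∀ {Γ φ} → φ ∈ Γ → Γ ▷ φ)
  (ruleT : ∀ {Γ Γ' ψ φ} → Γ ▷ ψ → (ψ ∷ Γ') ▷ φ → (Γ ++ Γ') ▷ φ)
  (ruleM : ∀ {Γ Δ φ} → Γ ▷ φ → Γ ⊆ Δ → Δ ▷ φ)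
  (ruleR⇒ : ∀ {Γ φ ψ} → (φ ∷ Γ) ▷ ψ → Γ ▷ (φ ⇒ ψ))
  (∨I₁ : ∀ {φ ψ} → (φ ∷ []) ▷ (φ ∨ ψ))
  (∨I₂ : ∀ {φ ψ} → (ψ ∷ []) ▷ (φ ∨ ψ))
  (∨E : ∀ {φ ψ δ} → ((φ ∨ ψ) ∷ (φ ⇒ δ) ∷ (ψ ⇒ δ) ∷ []) ▷ δ)
  (⇒E : ∀ {φ ψ} → (φ ∷ (φ ⇒ ψ) ∷ []) ▷ ψ)
  where

  cut : ∀ {Γ ψ φ} → Γ ▷ ψ → (ψ ∷ Γ) ▷ φ → Γ ▷ φ
  cut {Γ} d e = ruleM (ruleT d e) (λ p → [ id , id ]′ (∈-++⁻ Γ p))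

  discharge : ∀ {Δ Γ φ} → (Δ ++ Γ) ▷ φ → All (Γ ▷_) Δ → Γ ▷ φ
  discharge d [] = d
  discharge {a ∷ Δ} {Γ} d (da ∷ ds) = discharge (cut (ruleM da (xs⊆ys++xs Γ Δ)) d) ds

  apply : ∀ {Δ Γ φ} → Δ ▷ φ → All (Γ ▷_) Δ → Γ ▷ φ
  apply {Δ} {Γ} ax = discharge (ruleM ax (xs⊆xs++ys Δ Γ))

  ∨-elim : ∀ {Γ φ ψ δ} → Γ ▷ (φ ∨ ψ) → (φ ∷ Γ) ▷ δ → (ψ ∷ Γ) ▷ δ → Γ ▷ δ
  ∨-elim d e₁ e₂ = apply ∨E (d ∷ ruleR⇒ e₁ ∷ ruleR⇒ e₂ ∷ [])

  ∨-left : ∀ {Γ φ ψ δ} → (φ ∷ Γ) ▷ δ → (ψ ∷ Γ) ▷ δ → ((φ ∨ ψ) ∷ Γ) ▷ δ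
  ∨-left {φ = φ} {ψ} e₁ e₂ =
    ∨-elim (ruleR (here refl)) (ruleM e₁ (∷⁺ʳ φ there)) (ruleM e₂ (∷⁺ʳ ψ there))

  ⇒-elim : ∀ {Γ φ ψ} → Γ ▷ (φ ⇒ ψ) → Γ ▷ φ → Γ ▷ ψ
  ⇒-elim d e = apply ⇒E (e ∷ d ∷ [])

  ∨⊥-intro : ∀ {Γ φ} → Γ ▷ φ → Γ ▷ (φ ∨ ⊥)
  ∨⊥-intro d = apply ∨I₁ (d ∷ [])

  ∨⊥-map : ∀ {Γ φ ψ} → (φ ∷ Γ) ▷ ψ → Γ ▷ (φ ∨ ⊥) → Γ ▷ (ψ ∨ ⊥)
  ∨⊥-map f d = ∨-elim d (∨⊥-intro f) (apply ∨I₂ (ruleR (here refl) ∷ []))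

  ∨⊥-cut : ∀ {Γ Γ' ψ φ} → Γ ▷ (ψ ∨ ⊥) → (ψ ∷ Γ') ▷ (φ ∨ ⊥) → (Γ ++ Γ') ▷ (φ ∨ ⊥)
  ∨⊥-cut d e = ruleT d (∨-left e (apply ∨I₂ (ruleR (here refl) ∷ [])))

  module _ (efq : ∀ {φ} → (⊥ ∷ []) ▷ φ) where

    ∨⊥-elim : ∀ {Γ φ} → Γ ▷ (φ ∨ ⊥) → Γ ▷ φ
    ∨⊥-elim d = ∨-elim d (ruleR (here refl)) (apply efq (ruleR (here refl) ∷ []))

    ⇒∨⊥-elim : ∀ {φ ψ} → ((φ ⇒ (ψ ∨ ⊥)) ∷ []) ▷ (φ ⇒ ψ)
    ⇒∨⊥-elim = ruleR⇒ (∨⊥-elim (⇒-elim (ruleR (there (here refl))) (ruleR (here refl))))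

module Propositional (A : Set) where
  open Prop A

  module _ {Ax : List Form → Form → Set} {efq : Bool} where
    open PositiveEntailment _∨'_ _⇒_ ⊥' (Der Ax efq) ruleR ruleT ruleM ruleR⇒ ∨I₁ ∨I₂ ∨E ⇒E public

  ⊢i⇔Star∨⊥ : (List Form → Form → Set) → Set
  ⊢i⇔Star∨⊥ Ax = ∀ Γ φ → Γ ⊢i φ ⇔ Star Ax Γ (φ ∨' ⊥')

  ⇒∨⊥-Condition : (List Form → Form → Set) → Set
  ⇒∨⊥-Condition Ax = ∀ φ ψ → Star Ax ((φ ⇒ (ψ ∨' ⊥')) ∷ []) ((φ ⇒ ψ) ∨' ⊥')

  module _ {Ax} (b : ⇒∨⊥-Condition Ax) where

    ⊢i⇒Star∨⊥ : ∀ {Γ φ} → Γ ⊢i φ → Star Ax Γ (φ ∨' ⊥')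
    ⊢i⇒Star∨⊥ (ruleR p) = ∨⊥-intro (ruleR p)
    ⊢i⇒Star∨⊥ (ruleT d e) = ∨⊥-cut (⊢i⇒Star∨⊥ d) (⊢i⇒Star∨⊥ e)
    ⊢i⇒Star∨⊥ (ruleM d s) = ruleM (⊢i⇒Star∨⊥ d) s
    ⊢i⇒Star∨⊥ (ruleR⇒ d) = apply (b _ _) (ruleR⇒ (⊢i⇒Star∨⊥ d) ∷ [])
    ⊢i⇒Star∨⊥ ∧I = ∨⊥-intro ∧I
    ⊢i⇒Star∨⊥ ∧E₁ = ∨⊥-intro ∧E₁
    ⊢i⇒Star∨⊥ ∧E₂ = ∨⊥-intro ∧E₂
    ⊢i⇒Star∨⊥ ∨I₁ = ∨⊥-intro ∨I₁
    ⊢i⇒Star∨⊥ ∨I₂ = ∨⊥-intro ∨I₂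
    ⊢i⇒Star∨⊥ ∨E = ∨⊥-intro ∨E
    ⊢i⇒Star∨⊥ ⇒E = ∨⊥-intro ⇒E
    ⊢i⇒Star∨⊥ ⊤I = ∨⊥-intro ⊤I
    ⊢i⇒Star∨⊥ ¬I = ∨⊥-intro ¬I
    ⊢i⇒Star∨⊥ ¬E = ∨⊥-intro ¬E
    ⊢i⇒Star∨⊥ (efqAx _) = ∨I₂
    ⊢i⇒Star∨⊥ (extra ())

  characterisation : ∀ Ax → (∀ Γ φ → Star Ax Γ φ → Γ ⊢i φ) → ⊢i⇔Star∨⊥ Ax ⇔ ⇒∨⊥-Condition Ax
  characterisation Ax Star⊆⊢i = mk⇔
    (λ a φ ψ → Equivalence.to (a _ _) (⇒∨⊥-elim (efqAx refl)))
    (λ b Γ φ → mk⇔ (⊢i⇒Star∨⊥ b) (λ d → ∨⊥-elim (efqAx refl) (Star⊆⊢i _ _ d)))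

module Predicate (Sig : Signature) where
  open FOL Sig

  module _ {Ax : List Form → Form → Set} {efq quant : Bool} where
    open PositiveEntailment _∨'_ _⇒_ ⊥' (Der Ax efq quant) ruleR ruleT ruleM ruleR⇒ ∨I₁ ∨I₂ ∨E ⇒E public

  module _ (σ : ℕ → Term) (ρ : ℕ → ℕ) (σ∘ρ≗var : ∀ n → σ (ρ n) ≡ var n) where

    subT-renT-cancel : ∀ t → subT σ (renT ρ t) ≡ t
    subTs-renTs-cancel : ∀ {k} (ts : Vec Term k) → subTs σ (renTs ρ ts) ≡ ts
    subT-renT-cancel (var x) = σ∘ρ≗var x
    subT-renT-cancel (fn f ts) = cong (fn f) (subTs-renTs-cancel ts)
    subTs-renTs-cancel [] = refl
    subTs-renTs-cancel (t ∷ ts) = cong₂ _∷_ (subT-renT-cancel t) (subTs-renTs-cancel ts)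

    exts-ext-cancel : ∀ n → exts σ (ext ρ n) ≡ var n
    exts-ext-cancel zero = refl
    exts-ext-cancel (suc n) = cong (renT suc) (σ∘ρ≗var n)

  subF-renF-cancel : ∀ σ ρ → (∀ n → σ (ρ n) ≡ var n) → ∀ φ → subF σ (renF ρ φ) ≡ φ
  subF-renF-cancel σ ρ h (rel p ts) = cong (rel p) (subTs-renTs-cancel σ ρ h ts)
  subF-renF-cancel σ ρ h ⊤' = refl
  subF-renF-cancel σ ρ h ⊥' = refl
  subF-renF-cancel σ ρ h (φ ∧' ψ) = cong₂ _∧'_ (subF-renF-cancel σ ρ h φ) (subF-renF-cancel σ ρ h ψ)
  subF-renF-cancel σ ρ h (φ ∨' ψ) = cong₂ _∨'_ (subF-renF-cancel σ ρ h φ) (subF-renF-cancel σ ρ h ψ)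
  subF-renF-cancel σ ρ h (φ ⇒ ψ) = cong₂ _⇒_ (subF-renF-cancel σ ρ h φ) (subF-renF-cancel σ ρ h ψ)
  subF-renF-cancel σ ρ h (¬' φ) = cong ¬'_ (subF-renF-cancel σ ρ h φ)
  subF-renF-cancel σ ρ h (∀' φ) = cong ∀' (subF-renF-cancel (exts σ) (ext ρ) (exts-ext-cancel σ ρ h) φ)
  subF-renF-cancel σ ρ h (∃' φ) = cong ∃' (subF-renF-cancel (exts σ) (ext ρ) (exts-ext-cancel σ ρ h) φ)

  renF-ext-suc-[var0] : ∀ φ → renF (ext suc) φ [ var 0 ] ≡ φ
  renF-ext-suc-[var0] = subF-renF-cancel (single (var 0)) (ext suc) single-var0∘ext-suc
    where
    single-var0∘ext-suc : ∀ n → single (var 0) (ext suc n) ≡ var n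
    single-var0∘ext-suc zero = refl
    single-var0∘ext-suc (suc n) = refl

  module _ {Ax Ax' : List Form → Form → Set} {efq efq' quant quant' : Bool}
           (efq⇒ : efq ≡ true → efq' ≡ true) (quant⇒ : quant ≡ true → quant' ≡ true)
           (ax⇒ : ∀ {Γ φ} → Ax Γ φ → Der Ax' efq' quant' Γ φ) where

    Der-mono : ∀ {Γ φ} → Der Ax efq quant Γ φ → Der Ax' efq' quant' Γ φ
    Der-mono (ruleR p) = ruleR p
    Der-mono (ruleT d d') = ruleT (Der-mono d) (Der-mono d')
    Der-mono (ruleM d s) = ruleM (Der-mono d) s
    Der-mono (ruleR⇒ d) = ruleR⇒ (Der-mono d)
    Der-mono ∧I = ∧I
    Der-mono ∧E₁ = ∧E₁
    Der-mono ∧E₂ = ∧E₂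
    Der-mono ∨I₁ = ∨I₁
    Der-mono ∨I₂ = ∨I₂
    Der-mono ∨E = ∨E
    Der-mono ⇒E = ⇒E
    Der-mono ⊤I = ⊤I
    Der-mono ¬I = ¬I
    Der-mono ¬E = ¬E
    Der-mono (efqAx p) = efqAx (efq⇒ p)
    Der-mono (extra a) = ax⇒ a
    Der-mono (L∀ t p d) = L∀ t (quant⇒ p) (Der-mono d)
    Der-mono (R∀ p d) = R∀ (quant⇒ p) (Der-mono d)
    Der-mono (L∃ p d) = L∃ (quant⇒ p) (Der-mono d)
    Der-mono (R∃ t p d) = R∃ t (quant⇒ p) (Der-mono d)

  ⊢i⇒⊢iQ : ∀ {Γ φ} → Γ ⊢i φ → Γ ⊢iQ φ
  ⊢i⇒⊢iQ = Der-mono id (λ ()) (λ ())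

  StarQ⇒⊢iQ : ∀ {Ax} → (∀ Γ φ → Star Ax Γ φ → Γ ⊢i φ) → ∀ {Γ φ} → StarQ Ax Γ φ → Γ ⊢iQ φ
  StarQ⇒⊢iQ Star⊆⊢i = Der-mono (λ ()) id (λ a → ⊢i⇒⊢iQ (Star⊆⊢i _ _ (extra a)))

  ∀∨⊥⊢iQ∀ : ∀ {φ} → (∀' (φ ∨' ⊥') ∷ []) ⊢iQ ∀' φ
  ∀∨⊥⊢iQ∀ {φ} = R∀ refl (L∀ (var 0) refl instance⊢φ)
    where
    instance⊢φ : ((renF (ext suc) φ [ var 0 ] ∨' ⊥') ∷ map shift (∀' (φ ∨' ⊥') ∷ [])) ⊢iQ φ
    instance⊢φ rewrite renF-ext-suc-[var0] φ = ∨⊥-elim (efqAx refl) (ruleR (here refl))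

  ⊢iQ⇔StarQ∨⊥ : (List Form → Form → Set) → Set
  ⊢iQ⇔StarQ∨⊥ Ax = ∀ Γ φ → Γ ⊢iQ φ ⇔ StarQ Ax Γ (φ ∨' ⊥')

  ⇒∨⊥-Condition : (List Form → Form → Set) → Set
  ⇒∨⊥-Condition Ax = ∀ φ ψ → StarQ Ax ((φ ⇒ (ψ ∨' ⊥')) ∷ []) ((φ ⇒ ψ) ∨' ⊥')

  ∀∨⊥-Condition : (List Form → Form → Set) → Set
  ∀∨⊥-Condition Ax = ∀ φ → StarQ Ax (∀' (φ ∨' ⊥') ∷ []) (∀' φ ∨' ⊥')

  module _ {Ax} (b : ⇒∨⊥-Condition Ax) (b∀ : ∀∨⊥-Condition Ax) where

    ⊢iQ⇒StarQ∨⊥ : ∀ {Γ φ} → Γ ⊢iQ φ → StarQ Ax Γ (φ ∨' ⊥')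
    ⊢iQ⇒StarQ∨⊥ (ruleR p) = ∨⊥-intro (ruleR p)
    ⊢iQ⇒StarQ∨⊥ (ruleT d e) = ∨⊥-cut (⊢iQ⇒StarQ∨⊥ d) (⊢iQ⇒StarQ∨⊥ e)
    ⊢iQ⇒StarQ∨⊥ (ruleM d s) = ruleM (⊢iQ⇒StarQ∨⊥ d) s
    ⊢iQ⇒StarQ∨⊥ (ruleR⇒ d) = apply (b _ _) (ruleR⇒ (⊢iQ⇒StarQ∨⊥ d) ∷ [])
    ⊢iQ⇒StarQ∨⊥ ∧I = ∨⊥-intro ∧I
    ⊢iQ⇒StarQ∨⊥ ∧E₁ = ∨⊥-intro ∧E₁
    ⊢iQ⇒StarQ∨⊥ ∧E₂ = ∨⊥-intro ∧E₂
    ⊢iQ⇒StarQ∨⊥ ∨I₁ = ∨⊥-intro ∨I₁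
    ⊢iQ⇒StarQ∨⊥ ∨I₂ = ∨⊥-intro ∨I₂
    ⊢iQ⇒StarQ∨⊥ ∨E = ∨⊥-intro ∨E
    ⊢iQ⇒StarQ∨⊥ ⇒E = ∨⊥-intro ⇒E
    ⊢iQ⇒StarQ∨⊥ ⊤I = ∨⊥-intro ⊤I
    ⊢iQ⇒StarQ∨⊥ ¬I = ∨⊥-intro ¬I
    ⊢iQ⇒StarQ∨⊥ ¬E = ∨⊥-intro ¬E
    ⊢iQ⇒StarQ∨⊥ (efqAx _) = ∨I₂
    ⊢iQ⇒StarQ∨⊥ (extra ())
    ⊢iQ⇒StarQ∨⊥ (L∀ t q d) = L∀ t q (⊢iQ⇒StarQ∨⊥ d)
    ⊢iQ⇒StarQ∨⊥ (R∀ q d) = apply (b∀ _) (R∀ q (⊢iQ⇒StarQ∨⊥ d) ∷ [])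
    ⊢iQ⇒StarQ∨⊥ (L∃ q d) = L∃ q (⊢iQ⇒StarQ∨⊥ d)
    ⊢iQ⇒StarQ∨⊥ (R∃ t q d) = ∨⊥-map (R∃ t q (ruleR (here refl))) (⊢iQ⇒StarQ∨⊥ d)

  characterisation : ∀ Ax → (∀ Γ φ → Star Ax Γ φ → Γ ⊢i φ) →
                     ⊢iQ⇔StarQ∨⊥ Ax ⇔ (⇒∨⊥-Condition Ax × ∀∨⊥-Condition Ax)
  characterisation Ax Star⊆⊢i = mk⇔
    (λ a → (λ φ ψ → Equivalence.to (a _ _) (⇒∨⊥-elim (efqAx refl)))
         , (λ φ → Equivalence.to (a _ _) ∀∨⊥⊢iQ∀))
    (λ (b , b∀) Γ φ →
      mk⇔ (⊢iQ⇒StarQ∨⊥ b b∀) (λ d → ∨⊥-elim (efqAx refl) (StarQ⇒⊢iQ Star⊆⊢i d)))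

mainTheorem7 :
      ((A : Set) (Ax : List (Prop.Form A) → Prop.Form A → Set) →
        (∀ Γ φ → Prop.Star A Ax Γ φ → Prop._⊢i_ A Γ φ) →
        ((∀ Γ φ → (Prop._⊢i_ A Γ φ ⇔ Prop.Star A Ax Γ (Prop._∨'_ φ (Prop.⊥' {A}))))
          ⇔ (∀ φ ψ → Prop.Star A Ax (Prop._⇒_ φ (Prop._∨'_ ψ (Prop.⊥' {A})) ∷ [])
                                     (Prop._∨'_ (Prop._⇒_ φ ψ) (Prop.⊥' {A})))))
    × ((Sig : Signature) (Ax : List (FOL.Form Sig) → FOL.Form Sig → Set) →
        (∀ Γ φ → FOL.Star Sig Ax Γ φ → FOL._⊢i_ Sig Γ φ) →
        ((∀ Γ φ → (FOL._⊢iQ_ Sig Γ φ ⇔ FOL.StarQ Sig Ax Γ (FOL._∨'_ φ (FOL.⊥' {Sig}))))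
          ⇔ ((∀ φ ψ → FOL.StarQ Sig Ax (FOL._⇒_ φ (FOL._∨'_ ψ (FOL.⊥' {Sig})) ∷ [])
                                        (FOL._∨'_ (FOL._⇒_ φ ψ) (FOL.⊥' {Sig})))
             × (∀ φ → FOL.StarQ Sig Ax (FOL.∀' (FOL._∨'_ φ (FOL.⊥' {Sig})) ∷ [])
                                        (FOL._∨'_ (FOL.∀' φ) (FOL.⊥' {Sig}))))))
mainTheorem7 = Propositional.characterisation , Predicate.characterisation
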